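{- (1) For every $\lambda$-term $t$, $(t^{v})^{ - } = t$. (2) For every $M \in \mathcal{M}$ and $U \in \mathcal{U}_v$, $M\{U/x\} \in \mathcal{M}$ and $(M\{U/x\})^{ - } = M^{ - }\{U^{ - }/x\}$. (3) For every $M\in\mathcal{M}$ and every bang-calculus term $T$, if $M \to_{\mathsf{b}} T$ then $T \in \mathcal{M}$ and either $M^{ - } = T^{ - }$ or $M^{ - }\to_{\beta_v} T^{ - }$.
   Context: $\lambda$-terms: $t ::= x \mid \lambda x\,t \mid t\,s$; $\lambda$-values are variables and abstractions; $(\lambda x\,t)\,V \mapsto_{\beta_v} t\{V/x\}$ for $V$ a $\lambda$-value, and $\to_{\beta_v}$ is its closure under all $\lambda$-contexts $C ::= [\cdot]\mid \lambda x\,C \mid C\,t \mid t\,C$. Bang calculus: terms $T,S ::= x \mid \lambda x\,T \mid T\,S \mid \mathrm{der}\,T \mid {!T}$ (up to $\alpha$-conversion, capture-avoiding substitution); contexts $C ::= [\cdot] \mid \lambda x\,C \mid C\,T \mid T\,C \mid \mathrm{der}\,C \mid {!C}$; root steps $(\lambda x\,T)\,({!S}) \mapsto_{\mathsf{v}} T\{S/x\}$ and $\mathrm{der}\,({!T})\mapsto_{\mathsf{d}} T$; $\to_{\mathsf{b}}$ is the closure of $\mapsto_{\mathsf{v}}\cup\mapsto_{\mathsf{d}}$ under contexts. CbV translation: $x^{v} = {!x}$, $(\lambda x\,t)^{v} = {!(\lambda x\,t^{v})}$, $(t\,s)^{v} = (\mathrm{der}\,t^{v})\,s^{v}$. The sets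 $\mathcal{M}$ and $\mathcal{U}_v$ of bang terms are defined by mutual induction: $M,N ::= {!U} \mid (\mathrm{der}\,M)\,N \mid U\,M$ (set $\mathcal{M}$) and $U ::= x \mid \lambda x\,M$ (set $\mathcal{U}_v$). The forgetful map $(\cdot)^{ - }\colon \mathcal{M}\cup\mathcal{U}_v \to$ $\lambda$-terms is: $({!U})^{ - } = U^{ - }$, $((\mathrm{der}\,M)\,N)^{ - } = M^{ - }\,N^{ - }$, $(U\,M)^{ - } = U^{ - }\,M^{ - }$, $x^{ - } = x$, $(\lambda x\,M)^{ - } = \lambda x\,M^{ - }$. -}

module Defs where

open import Data.Nat using (ℕ; zero; suc)
open import Data.Fin using (Fin; zero; suc; _≟_; punchOut)
open import Data.Product using (Σ; _×_; _,_)
open import Data.Sum using (_⊎_)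
open import Relation.Nullary using (yes; no)
open import Relation.Binary.PropositionalEquality using (_≡_)

-- Terms are well-scoped de Bruijn terms (α-equivalence classes):
-- an element of Λ n / Bang n has free variables among Fin n.

data Λ (n : ℕ) : Set where
  var : Fin n → Λ n
  lam : Λ (suc n) → Λ n
  app : Λ n → Λ n → Λ n

extʳ : ∀ {m n} → (Fin m → Fin n) → Fin (suc m) → Fin (suc n)
extʳ ρ zero    = zero
extʳ ρ (suc i) = suc (ρ i)

renΛ : ∀ {m n} → (Fin m → Fin n) → Λ m → Λ n
renΛ ρ (var i)   = var (ρ i)
renΛ ρ (lam t)   = lam (renΛ (extʳ ρ) t)
renΛ ρ (app t s) = app (renΛ ρ t) (renΛ ρ s)

extsΛ : ∀ {m n} → (Fin m → Λ n) → Fin (suc m) → Λ (suc n)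
extsΛ σ zero    = var zero
extsΛ σ (suc i) = renΛ suc (σ i)

subΛ : ∀ {m n} → (Fin m → Λ n) → Λ m → Λ n
subΛ σ (var i)   = σ i
subΛ σ (lam t)   = lam (subΛ (extsΛ σ) t)
subΛ σ (app t s) = app (subΛ σ t) (subΛ σ s)

_[_/_]Λ : ∀ {n} → Λ (suc n) → Λ n → Fin (suc n) → Λ n
t [ s / x ]Λ = subΛ σ t
  where
  σ : Fin (suc _) → Λ _
  σ y with x ≟ y
  ... | yes _  = s
  ... | no x≢y = var (punchOut x≢y)

data IsValueΛ {n : ℕ} : Λ n → Set where
  var : (i : Fin n) → IsValueΛ (var i)
  lam : (t : Λ (suc n)) → IsValueΛ (lam t)

data _→βv_ {n : ℕ} : Λ n → Λ n → Set where
  βv   : ∀ (t : Λ (suc n)) (v : Λ n) → IsValueΛ v →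
         app (lam t) v →βv (t [ v / zero ]Λ)
  ξlam : ∀ {t t' : Λ (suc n)} → t →βv t' → lam t →βv lam t'
  ξappl : ∀ {t t' s} → t →βv t' → app t s →βv app t' s
  ξappr : ∀ {t s s'} → s →βv s' → app t s →βv app t s'

data Bang (n : ℕ) : Set where
  var  : Fin n → Bang n
  lam  : Bang (suc n) → Bang n
  app  : Bang n → Bang n → Bang n
  der  : Bang n → Bang n
  bang : Bang n → Bang n

renB : ∀ {m n} → (Fin m → Fin n) → Bang m → Bang n
renB ρ (var i)   = var (ρ i)
renB ρ (lam t)   = lam (renB (extʳ ρ) t)
renB ρ (app t s) = app (renB ρ t) (renB ρ s)
renB ρ (der t)   = der (renB ρ t)
renB ρ (bang t)  = bang (renB ρ t)

extsB : ∀ {m n} → (Fin m → Bang n) → Fin (suc m) → Bang (suc n)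
extsB σ zero    = var zero
extsB σ (suc i) = renB suc (σ i)

subB : ∀ {m n} → (Fin m → Bang n) → Bang m → Bang n
subB σ (var i)   = σ i
subB σ (lam t)   = lam (subB (extsB σ) t)
subB σ (app t s) = app (subB σ t) (subB σ s)
subB σ (der t)   = der (subB σ t)
subB σ (bang t)  = bang (subB σ t)

_[_/_]B : ∀ {n} → Bang (suc n) → Bang n → Fin (suc n) → Bang n
t [ s / x ]B = subB σ t
  where
  σ : Fin (suc _) → Bang _
  σ y with x ≟ y
  ... | yes _  = s
  ... | no x≢y = var (punchOut x≢y)

data _→b_ {n : ℕ} : Bang n → Bang n → Set where
  rootv : ∀ (T : Bang (suc n)) (S : Bang n) →
          app (lam T) (bang S) →b (T [ S / zero ]B)
  rootd : ∀ (T : Bang n) → der (bang T) →b T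
  ξlam  : ∀ {T T' : Bang (suc n)} → T →b T' → lam T →b lam T'
  ξappl : ∀ {T T' S} → T →b T' → app T S →b app T' S
  ξappr : ∀ {T S S'} → S →b S' → app T S →b app T S'
  ξder  : ∀ {T T'} → T →b T' → der T →b der T'
  ξbang : ∀ {T T'} → T →b T' → bang T →b bang T'

_ᵛ : ∀ {n} → Λ n → Bang n
var x ᵛ   = bang (var x)
lam t ᵛ   = bang (lam (t ᵛ))
app t s ᵛ = app (der (t ᵛ)) (s ᵛ)

data 𝓜 {n : ℕ} : Bang n → Set
data 𝓤 {n : ℕ} : Bang n → Set

data 𝓜 {n} where
  bang : ∀ {U} → 𝓤 U → 𝓜 (bang U)
  derapp : ∀ {M N} → 𝓜 M → 𝓜 N → 𝓜 (app (der M) N)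
  uapp : ∀ {U M} → 𝓤 U → 𝓜 M → 𝓜 (app U M)

data 𝓤 {n} where
  var : (x : Fin n) → 𝓤 (var x)
  lam : ∀ {M : Bang (suc n)} → 𝓜 M → 𝓤 (lam M)

-- forgetful map, defined on membership derivations (the grammar is
-- unambiguous, so each term of 𝓜 ∪ 𝓤v has exactly one derivation)
forgetM : ∀ {n} {M : Bang n} → 𝓜 M → Λ n
forgetU : ∀ {n} {U : Bang n} → 𝓤 U → Λ n

forgetM (bang u)     = forgetU u
forgetM (derapp m p) = app (forgetM m) (forgetM p)
forgetM (uapp u m)   = app (forgetU u) (forgetM m)

forgetU (var x) = var x
forgetU (lam m) = lam (forgetM m)

-- 𝓜 extends the image of the CbV translation by the terms U M produced by
-- the administrative step der (!U) ↦ U, which the forgetful map erases.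
-- Members of 𝓤 only ever stand in variable positions and forget to
-- λ-values, so substituting them preserves 𝓜 and commutes with forgetting;
-- hence every ↦v step on 𝓜 is a βv step, every ↦d step an identity, and
-- contexts carry both along.
module Submission where

open import Defs
open import Data.Nat using (ℕ; suc)
open import Data.Fin using (Fin; zero; suc; _≟_)
open import Data.Product using (Σ; _×_; _,_)
open import Data.Sum using (_⊎_; inj₁; inj₂)
open import Relation.Nullary using (yes; no)
open import Relation.Binary.PropositionalEquality
  using (_≡_; _≗_; refl; cong; cong₂; sym; trans; subst)

variable
  m n : ℕ

𝓜-ᵛ : (t : Λ n) → 𝓜 (t ᵛ)
𝓜-ᵛ (var x)   = bang (var x)
𝓜-ᵛ (lam t)   = bang (lam (𝓜-ᵛ t))
𝓜-ᵛ (app t s) = derapp (𝓜-ᵛ t) (𝓜-ᵛ s)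

forgetM-ᵛ : (t : Λ n) → forgetM (𝓜-ᵛ t) ≡ t
forgetM-ᵛ (var x)   = refl
forgetM-ᵛ (lam t)   = cong lam (forgetM-ᵛ t)
forgetM-ᵛ (app t s) = cong₂ app (forgetM-ᵛ t) (forgetM-ᵛ s)

𝓜-renB : (ρ : Fin m → Fin n) {M : Bang m} → 𝓜 M → 𝓜 (renB ρ M)
𝓤-renB : (ρ : Fin m → Fin n) {U : Bang m} → 𝓤 U → 𝓤 (renB ρ U)
𝓜-renB ρ (bang u)     = bang (𝓤-renB ρ u)
𝓜-renB ρ (derapp m p) = derapp (𝓜-renB ρ m) (𝓜-renB ρ p)
𝓜-renB ρ (uapp u m)   = uapp (𝓤-renB ρ u) (𝓜-renB ρ m)
𝓤-renB ρ (var x)      = var (ρ x)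
𝓤-renB ρ (lam m)      = lam (𝓜-renB (extʳ ρ) m)

forgetM-renB : (ρ : Fin m → Fin n) {M : Bang m} (m : 𝓜 M) →
               forgetM (𝓜-renB ρ m) ≡ renΛ ρ (forgetM m)
forgetU-renB : (ρ : Fin m → Fin n) {U : Bang m} (u : 𝓤 U) →
               forgetU (𝓤-renB ρ u) ≡ renΛ ρ (forgetU u)
forgetM-renB ρ (bang u)     = forgetU-renB ρ u
forgetM-renB ρ (derapp m p) = cong₂ app (forgetM-renB ρ m) (forgetM-renB ρ p)
forgetM-renB ρ (uapp u m)   = cong₂ app (forgetU-renB ρ u) (forgetM-renB ρ m)
forgetU-renB ρ (var x)      = refl
forgetU-renB ρ (lam m)      = cong lam (forgetM-renB (extʳ ρ) m)

subΛ-cong : {σ τ : Fin m → Λ n} → σ ≗ τ → subΛ σ ≗ subΛ τ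
subΛ-cong σ≗τ (var i)   = σ≗τ i
subΛ-cong σ≗τ (lam t)   = cong lam (subΛ-cong (extsΛ-cong σ≗τ) t)
  where
  extsΛ-cong : {σ τ : Fin m → Λ n} → σ ≗ τ → extsΛ σ ≗ extsΛ τ
  extsΛ-cong σ≗τ zero    = refl
  extsΛ-cong σ≗τ (suc i) = cong (renΛ suc) (σ≗τ i)
subΛ-cong σ≗τ (app t s) = cong₂ app (subΛ-cong σ≗τ t) (subΛ-cong σ≗τ s)

𝓤Sub : (Fin m → Bang n) → Set
𝓤Sub σ = ∀ i → 𝓤 (σ i)

forgetSub : {σ : Fin m → Bang n} → 𝓤Sub σ → Fin m → Λ n
forgetSub us i = forgetU (us i)

𝓤Sub-extsB : {σ : Fin m → Bang n} → 𝓤Sub σ → 𝓤Sub (extsB σ)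
𝓤Sub-extsB us zero    = var zero
𝓤Sub-extsB us (suc i) = 𝓤-renB suc (us i)

forgetSub-extsB : {σ : Fin m → Bang n} (us : 𝓤Sub σ) →
                  forgetSub (𝓤Sub-extsB us) ≗ extsΛ (forgetSub us)
forgetSub-extsB us zero    = refl
forgetSub-extsB us (suc i) = forgetU-renB suc (us i)

𝓜-subB : {σ : Fin m → Bang n} → 𝓤Sub σ → {M : Bang m} → 𝓜 M → 𝓜 (subB σ M)
𝓤-subB : {σ : Fin m → Bang n} → 𝓤Sub σ → {U : Bang m} → 𝓤 U → 𝓤 (subB σ U)
𝓜-subB us (bang u)     = bang (𝓤-subB us u)
𝓜-subB us (derapp m p) = derapp (𝓜-subB us m) (𝓜-subB us p)
𝓜-subB us (uapp u m)   = uapp (𝓤-subB us u) (𝓜-subB us m)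
𝓤-subB us (var x)      = us x
𝓤-subB us (lam m)      = lam (𝓜-subB (𝓤Sub-extsB us) m)

forgetM-subB : {σ : Fin m → Bang n} (us : 𝓤Sub σ) {M : Bang m} (m : 𝓜 M) →
               forgetM (𝓜-subB us m) ≡ subΛ (forgetSub us) (forgetM m)
forgetU-subB : {σ : Fin m → Bang n} (us : 𝓤Sub σ) {U : Bang m} (u : 𝓤 U) →
               forgetU (𝓤-subB us u) ≡ subΛ (forgetSub us) (forgetU u)
forgetM-subB us (bang u)     = forgetU-subB us u
forgetM-subB us (derapp m p) = cong₂ app (forgetM-subB us m) (forgetM-subB us p)
forgetM-subB us (uapp u m)   = cong₂ app (forgetU-subB us u) (forgetM-subB us m)
forgetU-subB us (var x)      = refl
forgetU-subB us (lam m)      =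
  cong lam (trans (forgetM-subB (𝓤Sub-extsB us) m)
                  (subΛ-cong (forgetSub-extsB us) (forgetM m)))

𝓤Sub-single : (x : Fin (suc n)) {U : Bang n} → 𝓤 U →
              𝓤Sub (λ y → var y [ U / x ]B)
𝓤Sub-single x u y with x ≟ y
... | yes _ = u
... | no _  = var _

forgetSub-single : (x : Fin (suc n)) {U : Bang n} (u : 𝓤 U) →
                   forgetSub (𝓤Sub-single x u) ≗ (λ y → var y [ forgetU u / x ]Λ)
forgetSub-single x u y with x ≟ y
... | yes _ = refl
... | no _  = refl

𝓜-[/]B : (x : Fin (suc n)) {M : Bang (suc n)} {U : Bang n} →
         𝓜 M → 𝓤 U → 𝓜 (M [ U / x ]B)
𝓜-[/]B x m u = 𝓜-subB (𝓤Sub-single x u) m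

forgetM-[/]B : (x : Fin (suc n)) {M : Bang (suc n)} {U : Bang n} (m : 𝓜 M) (u : 𝓤 U) →
               forgetM (𝓜-[/]B x m u) ≡ forgetM m [ forgetU u / x ]Λ
forgetM-[/]B x m u = trans (forgetM-subB (𝓤Sub-single x u) m)
                           (subΛ-cong (forgetSub-single x u) (forgetM m))

infix 4 _→βv⁼_
_→βv⁼_ : Λ n → Λ n → Set
t →βv⁼ s = t ≡ s ⊎ t →βv s

→βv⁼-map : (f : Λ m → Λ n) → (∀ {t s} → t →βv s → f t →βv f s) →
           ∀ {t s} → t →βv⁼ s → f t →βv⁼ f s
→βv⁼-map f f-mono (inj₁ t≡s) = inj₁ (cong f t≡s)
→βv⁼-map f f-mono (inj₂ t→s) = inj₂ (f-mono t→s)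

forgetU-value : {U : Bang n} (u : 𝓤 U) → IsValueΛ (forgetU u)
forgetU-value (var x) = var x
forgetU-value (lam m) = lam _

forgetM-rootv : {M : Bang (suc n)} {U : Bang n} (m : 𝓜 M) (u : 𝓤 U) →
                app (lam (forgetM m)) (forgetU u) →βv forgetM (𝓜-[/]B zero m u)
forgetM-rootv m u =
  subst (app (lam (forgetM m)) (forgetU u) →βv_) (sym (forgetM-[/]B zero m u))
        (βv (forgetM m) (forgetU u) (forgetU-value u))

𝓤-→b : {U T : Bang n} (u : 𝓤 U) → U →b T → Σ (𝓤 T) (λ q → forgetU u →βv⁼ forgetU q)
𝓜-→b : {M T : Bang n} (m : 𝓜 M) → M →b T → Σ (𝓜 T) (λ q → forgetM m →βv⁼ forgetM q)
𝓤-→b (lam m) (ξlam r) with 𝓜-→b m r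
... | q , s = lam q , →βv⁼-map lam ξlam s
𝓜-→b (bang u) (ξbang r) with 𝓤-→b u r
... | q , s = bang q , s
𝓜-→b (derapp (bang u) p) (ξappl (rootd _)) = uapp u p , inj₁ refl
𝓜-→b (derapp m p) (ξappl (ξder r)) with 𝓜-→b m r
... | q , s = derapp q p , →βv⁼-map (λ t → app t (forgetM p)) ξappl s
𝓜-→b (derapp m p) (ξappr r) with 𝓜-→b p r
... | q , s = derapp m q , →βv⁼-map (app (forgetM m)) ξappr s
𝓜-→b (uapp (lam m) (bang u)) (rootv _ _) = 𝓜-[/]B zero m u , inj₂ (forgetM-rootv m u)
𝓜-→b (uapp u m) (ξappl r) with 𝓤-→b u r
... | q , s = uapp q m , →βv⁼-map (λ t → app t (forgetM m)) ξappl s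
𝓜-→b (uapp u m) (ξappr r) with 𝓜-→b m r
... | q , s = uapp u q , →βv⁼-map (app (forgetU u)) ξappr s

lemma12 : (∀ {n} (t : Λ n) → Σ (𝓜 (t ᵛ)) (λ p → forgetM p ≡ t))
          × (∀ {n} {M : Bang (suc n)} {U : Bang n} (x : Fin (suc n))
               (m : 𝓜 M) (u : 𝓤 U) →
               Σ (𝓜 (M [ U / x ]B))
                 (λ p → forgetM p ≡ (forgetM m) [ forgetU u / x ]Λ))
          × (∀ {n} {M T : Bang n} (m : 𝓜 M) → M →b T →
               Σ (𝓜 T) (λ q → (forgetM m ≡ forgetM q) ⊎ (forgetM m →βv forgetM q)))
lemma12 = (λ t → 𝓜-ᵛ t , forgetM-ᵛ t)
        , (λ x m u → 𝓜-[/]B x m u , forgetM-[/]B x m u)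
        , 𝓜-→b
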